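{- A cograph $G$ is a C-I graph if and only if the cotree of $G$ belongs to the family $\mathcal{T}_C$.
   Context: A cograph is a graph with no induced path on four vertices. For a finite poset $P=(V,\le)$, write $u\lhd v$ if $u<v$ and no $w$ satisfies $u<w<v$, and $u\,\|\,v$ if $u,v$ are incomparable; the C-I graph $G_P$ has vertex set $V$ with $uv$ an edge iff $u\lhd v$, $v\lhd u$, or $u\,\|\,v$; a graph is a C-I graph if isomorphic to some $G_P$. The cotree of a cograph $G$ is the unique rooted tree whose leaves are the vertices of $G$, whose internal nodes are labelled $0$ or $1$, in which labels alternate along every root-to-leaf path and every internal node has at least two children, and such that two vertices $x,y$ are adjacent in $G$ iff their lowest common ancestor is labelled $1$. $\mathcal{T}_C$ denotes the family of rooted trees $T$ such that either $T$ is a single leaf, or the root of $T$ is a $1$-node whose children are leaves and $0$-nodes with the number of $0$-node children at most the number of leaf children, every $0$-node has exactly two children each of which is a leaf or a $1$-node, and every non-root $1$-node has only leaves as children. -}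

module Defs where

open import Data.Nat using (ℕ; zero; suc; _+_; _≤_)
open import Data.Fin using (Fin)
open import Data.Bool using (Bool; true; false; not)
open import Data.List using (List; []; _∷_; length; lookup; _++_)
open import Data.List.Relation.Unary.All using (All)
open import Data.List.Relation.Unary.Unique.Propositional using (Unique)
open import Data.List.Membership.Propositional using (_∈_)
open import Data.Product using (Σ; ∃; _×_; _,_)
open import Data.Sum using (_⊎_)
open import Data.Empty using (⊥)
open import Data.Unit using (⊤)
open import Relation.Nullary using (¬_)
open import Relation.Binary.PropositionalEquality using (_≡_; _≢_)
open import Function.Bundles using (_↔_; _⇔_; Inverse)

record Graph (n : ℕ) : Set₁ where
  field
    Adj     : Fin n → Fin n → Set
    sym     : ∀ {u v} → Adj u v → Adj v u
    irrefl  : ∀ {u} → ¬ Adj u u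

open Graph public

IsCograph : ∀ {n} → Graph n → Set
IsCograph {n} G =
  ¬ (Σ (Fin n) λ a → Σ (Fin n) λ b → Σ (Fin n) λ c → Σ (Fin n) λ d →
       (a ≢ b × a ≢ c × a ≢ d × b ≢ c × b ≢ d × c ≢ d) ×
       (Adj G a b × Adj G b c × Adj G c d) ×
       (¬ Adj G a c × ¬ Adj G a d × ¬ Adj G b d))

record FinPoset (n : ℕ) : Set₁ where
  field
    _≼_      : Fin n → Fin n → Set
    refl≼    : ∀ {u} → u ≼ u
    antisym≼ : ∀ {u v} → u ≼ v → v ≼ u → u ≡ v
    trans≼   : ∀ {u v w} → u ≼ v → v ≼ w → u ≼ w

open FinPoset public

module _ {n : ℕ} (P : FinPoset n) where
  Lt : Fin n → Fin n → Set
  Lt u v = _≼_ P u v × u ≢ v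

  Covers : Fin n → Fin n → Set
  Covers u v = Lt u v × ¬ (Σ (Fin n) λ w → Lt u w × Lt w v)

  Incomp : Fin n → Fin n → Set
  Incomp u v = ¬ (_≼_ P u v) × ¬ (_≼_ P v u)

  CIEdge : Fin n → Fin n → Set
  CIEdge u v = Covers u v ⊎ Covers v u ⊎ Incomp u v

-- G is a C-I graph: isomorphic to G_P for some finite poset P
-- (an isomorphic poset necessarily has n elements, so P lives on Fin n)
IsCIGraph : ∀ {n} → Graph n → Set₁
IsCIGraph {n} G =
  Σ (FinPoset n) λ P → Σ (Fin n ↔ Fin n) λ f →
    ∀ u v → (Adj G u v ⇔ CIEdge P (Inverse.to f u) (Inverse.to f v))

-- Rooted trees with leaves labelled by vertices and internal nodes
-- labelled by Bool (false = 0-node, true = 1-node); children as a list.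

data Tree (n : ℕ) : Set where
  leaf : Fin n → Tree n
  node : Bool → List (Tree n) → Tree n

mutual
  leaves : ∀ {n} → Tree n → List (Fin n)
  leaves (leaf v)    = v ∷ []
  leaves (node _ cs) = leavesL cs

  leavesL : ∀ {n} → List (Tree n) → List (Fin n)
  leavesL []       = []
  leavesL (c ∷ cs) = leaves c ++ leavesL cs

ChildOk : ∀ {n} → Bool → Tree n → Set
ChildOk b (leaf _)     = ⊤
ChildOk b (node b' _)  = b' ≡ not b

data WellFormed {n : ℕ} : Tree n → Set where
  wf-leaf : ∀ v → WellFormed (leaf v)
  wf-node : ∀ b cs → 2 ≤ length cs → All (ChildOk b) cs →
            All WellFormed cs → WellFormed (node b cs)

-- LCA T x y b : the lowest common ancestor of x and y in T is a node
-- labelled b (x and y lie below two different children of that node)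
data LCA {n : ℕ} : Tree n → Fin n → Fin n → Bool → Set where
  here  : ∀ {b cs x y} (i j : Fin (length cs)) → i ≢ j →
          x ∈ leaves (lookup cs i) → y ∈ leaves (lookup cs j) →
          LCA (node b cs) x y b
  there : ∀ {b b' cs c x y} → c ∈ cs → LCA c x y b' → LCA (node b cs) x y b'

IsCotreeOf : ∀ {n} → Graph n → Tree n → Set
IsCotreeOf {n} G T =
  WellFormed T ×
  Unique (leaves T) × (∀ v → v ∈ leaves T) ×
  (∀ x y → x ≢ y → (Adj G x y ⇔ LCA T x y true))

IsLeaf : ∀ {n} → Tree n → Set
IsLeaf (leaf _)   = ⊤
IsLeaf (node _ _) = ⊥

Inner1 : ∀ {n} → Tree n → Set
Inner1 (leaf _)          = ⊥
Inner1 (node false _)    = ⊥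
Inner1 (node true cs)    = All IsLeaf cs

Zero2 : ∀ {n} → Tree n → Set
Zero2 (leaf _)                      = ⊥
Zero2 (node true _)                 = ⊥
Zero2 (node false (a ∷ b ∷ []))     = (IsLeaf a ⊎ Inner1 a) × (IsLeaf b ⊎ Inner1 b)
Zero2 (node false _)                = ⊥

countLeaves : ∀ {n} → List (Tree n) → ℕ
countLeaves []              = 0
countLeaves (leaf _ ∷ cs)   = suc (countLeaves cs)
countLeaves (node _ _ ∷ cs) = countLeaves cs

countZeroNodes : ∀ {n} → List (Tree n) → ℕ
countZeroNodes []                  = 0
countZeroNodes (leaf _ ∷ cs)       = countZeroNodes cs
countZeroNodes (node false _ ∷ cs) = suc (countZeroNodes cs)
countZeroNodes (node true _ ∷ cs)  = countZeroNodes cs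

InTC : ∀ {n} → Tree n → Set
InTC (leaf _)       = ⊤
InTC (node false _) = ⊥
InTC (node true cs) =
  All (λ c → IsLeaf c ⊎ Zero2 c) cs × countZeroNodes cs ≤ countLeaves cs

{-# OPTIONS --safe #-}
module Submission where

-- If G ≅ G_P is a cograph, then P has no chain of four elements: such a chain refines
-- to four consecutive covers, which induce a P₄ in G_P. Hence two non-adjacent vertices
-- are comparable with an element strictly between them, every such middle element is
-- adjacent to all other vertices, and G has no independent triple. In the cotree this
-- forces a 1-node root, 0-node children with exactly two children, and grandchildren
-- that are leaves or 1-nodes over leaves. A middle element between the two sides of a
-- 0-node child is a leaf child of the root, and distinct 0-node children get distinct
-- ones, so the leaf children are at least as many.
-- Conversely, for a tree in 𝒯_C pair the k-th 0-node child, with sides A and B, with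
-- the k-th leaf child ℓ, and order A < ℓ < B. In this poset of height three the
-- comparable pairs that are not covers are exactly the pairs in A × B, which are the
-- non-edges of G.

open import Defs hiding (sym)
open import Data.Nat using (ℕ; zero; suc; _+_; _≤_; _<_; z≤n; s≤s)
import Data.Nat.Properties as ℕ
open import Data.Fin using (Fin; zero; suc)
import Data.Fin.Properties as Fin
open import Data.Fin.Induction using (spo-wellFounded; spo-noetherian)
open import Induction.WellFounded using (Acc; acc)
open import Relation.Binary.Structures using (IsStrictPartialOrder)
open import Relation.Binary.Definitions using (Decidable; tri<; tri≈; tri>)
open import Data.Bool using (true; false)
open import Data.List using (List; []; _∷_; length; lookup; _++_)
import Data.List.Properties as List
open import Data.List.Relation.Unary.All as All using (All; []; _∷_)
import Data.List.Relation.Unary.All.Properties as All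
open import Data.List.Relation.Unary.Any using (here; there; index)
import Data.List.Relation.Unary.Any.Properties as Any
open import Data.List.Relation.Unary.AllPairs as AllPairs using (AllPairs; []; _∷_)
open import Data.List.Relation.Unary.Unique.Propositional using (Unique)
open import Data.List.Membership.Propositional using (_∈_)
open import Data.List.Membership.Propositional.Properties using (∈-++⁺ˡ; ∈-++⁺ʳ; ∈-++⁻; ∈-lookup; ∈-∃++)
open import Data.Product using (∃; ∃₂; ∃-syntax; _×_; _,_; proj₁; proj₂)
open import Data.Sum using (_⊎_; inj₁; inj₂; [_,_]′)
import Data.Sum as Sum
open import Data.Empty using (⊥; ⊥-elim)
open import Data.Unit using (⊤; tt)
open import Relation.Nullary using (¬_; Dec; yes; no)
open import Relation.Nullary.Decidable using (_×-dec_; _⊎-dec_; decidable-stable; ¬¬-excluded-middle)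
open import Relation.Nullary.Negation using (¬¬-map)
open import Relation.Binary.PropositionalEquality
  using (_≡_; _≢_; refl; sym; trans; cong; subst; subst₂; isEquivalence)
open import Function using (_∘_; flip)
open import Function.Bundles using (_⇔_; mk⇔; Inverse; _↔_; Equivalence)
open import Function.Construct.Identity using (↔-id)
open import Function.Construct.Composition using (_⇔-∘_)
open import Function.Construct.Symmetry using (⇔-sym)

Unique-++⁻ : ∀ {A : Set} (xs ys : List A) → Unique (xs ++ ys) →
  Unique xs × Unique ys × (∀ {x} → x ∈ xs → x ∈ ys → ⊥)
Unique-++⁻ [] ys u = [] , u , λ ()
Unique-++⁻ (x ∷ xs) ys (x∉ ∷ u) with Unique-++⁻ xs ys u
... | uxs , uys , disjoint = All.++⁻ˡ xs x∉ ∷ uxs , uys , disjoint′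
  where
  disjoint′ : ∀ {z} → z ∈ x ∷ xs → z ∈ ys → ⊥
  disjoint′ (here refl) z∈ys = All.lookup (All.++⁻ʳ xs x∉) z∈ys refl
  disjoint′ (there z∈xs) z∈ys = disjoint z∈xs z∈ys

∈-++-∷⁻ : ∀ {A : Set} (pre post : List A) {x y} → y ∈ pre ++ x ∷ post → y ≢ x → y ∈ pre ++ post
∈-++-∷⁻ [] post (here refl) y≢x = ⊥-elim (y≢x refl)
∈-++-∷⁻ [] post (there y∈) _ = y∈
∈-++-∷⁻ (z ∷ pre) post (here refl) _ = here refl
∈-++-∷⁻ (z ∷ pre) post (there y∈) y≢x = there (∈-++-∷⁻ pre post y∈ y≢x)

length-++-∷ : ∀ {A : Set} (pre post : List A) {x} → length (pre ++ x ∷ post) ≡ suc (length (pre ++ post))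
length-++-∷ [] post = refl
length-++-∷ (z ∷ pre) post = cong suc (length-++-∷ pre post)

Unique⇒length≤ : ∀ {A : Set} {xs ys : List A} → Unique xs → All (_∈ ys) xs → length xs ≤ length ys
Unique⇒length≤ {xs = []} _ _ = z≤n
Unique⇒length≤ {xs = x ∷ xs} (x∉ ∷ u) (x∈ys ∷ xs⊆ys) with pre , post , refl ← ∈-∃++ x∈ys =
  subst (suc (length xs) ≤_) (sym (length-++-∷ pre post))
    (s≤s (Unique⇒length≤ u (All.tabulate λ y∈xs →
      ∈-++-∷⁻ pre post (All.lookup xs⊆ys y∈xs) (λ y≡x → All.lookup x∉ y∈xs (sym y≡x)))))

module _ {n : ℕ} where

  ∈-leavesL⁺ : ∀ {c : Tree n} {cs x} → c ∈ cs → x ∈ leaves c → x ∈ leavesL cs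
  ∈-leavesL⁺ {cs = c ∷ cs} (here refl) x∈c = ∈-++⁺ˡ x∈c
  ∈-leavesL⁺ {cs = c′ ∷ cs} (there c∈cs) x∈c = ∈-++⁺ʳ (leaves c′) (∈-leavesL⁺ c∈cs x∈c)

  ∈-leavesL⁻ : ∀ (cs : List (Tree n)) {x} → x ∈ leavesL cs → ∃[ c ] c ∈ cs × x ∈ leaves c
  ∈-leavesL⁻ (c ∷ cs) x∈ with ∈-++⁻ (leaves c) x∈
  ... | inj₁ x∈c = c , here refl , x∈c
  ... | inj₂ x∈cs with c′ , c′∈ , x∈c′ ← ∈-leavesL⁻ cs x∈cs = c′ , there c′∈ , x∈c′

  ∈-leaves-index : ∀ {cs : List (Tree n)} {c x} (c∈ : c ∈ cs) → x ∈ leaves c →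
    x ∈ leaves (lookup cs (index c∈))
  ∈-leaves-index c∈ = subst (λ t → _ ∈ leaves t) (Any.lookup-index c∈)

  ∈-leaves-lookup⁺ : ∀ (cs : List (Tree n)) i {x} → x ∈ leaves (lookup cs i) → x ∈ leavesL cs
  ∈-leaves-lookup⁺ cs i = ∈-leavesL⁺ (∈-lookup {xs = cs} i)

  ∈-leaves-lookup⁻ : ∀ (cs : List (Tree n)) {x} → x ∈ leavesL cs → ∃[ i ] x ∈ leaves (lookup cs i)
  ∈-leaves-lookup⁻ cs x∈ with c , c∈ , x∈c ← ∈-leavesL⁻ cs x∈ = index c∈ , ∈-leaves-index c∈ x∈c

  leaves-nonempty : ∀ {t : Tree n} → WellFormed t → ∃[ x ] x ∈ leaves t
  leaves-nonempty (wf-leaf v) = v , here refl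
  leaves-nonempty (wf-node _ (c ∷ _) _ _ (wf ∷ _)) with x , x∈ ← leaves-nonempty wf = x , ∈-++⁺ˡ x∈

  Unique-leaves-child : ∀ {cs : List (Tree n)} {c} → Unique (leavesL cs) → c ∈ cs → Unique (leaves c)
  Unique-leaves-child {c ∷ cs} u (here refl) = proj₁ (Unique-++⁻ (leaves c) _ u)
  Unique-leaves-child {c ∷ cs} u (there c∈) =
    Unique-leaves-child (proj₁ (proj₂ (Unique-++⁻ (leaves c) _ u))) c∈

  leaves-lookup-disjoint : ∀ (cs : List (Tree n)) → Unique (leavesL cs) → ∀ {i j x} → i ≢ j →
    x ∈ leaves (lookup cs i) → x ∈ leaves (lookup cs j) → ⊥
  leaves-lookup-disjoint (c ∷ cs) u {zero} {zero} i≢j _ _ = i≢j refl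
  leaves-lookup-disjoint (c ∷ cs) u {zero} {suc j} _ x∈ x∈′ =
    proj₂ (proj₂ (Unique-++⁻ (leaves c) _ u)) x∈ (∈-leaves-lookup⁺ cs j x∈′)
  leaves-lookup-disjoint (c ∷ cs) u {suc i} {zero} _ x∈ x∈′ =
    proj₂ (proj₂ (Unique-++⁻ (leaves c) _ u)) x∈′ (∈-leaves-lookup⁺ cs i x∈)
  leaves-lookup-disjoint (c ∷ cs) u {suc i} {suc j} i≢j =
    leaves-lookup-disjoint cs (proj₁ (proj₂ (Unique-++⁻ (leaves c) _ u))) (i≢j ∘ cong suc)

  LCA⇒∈leaves : ∀ {t : Tree n} {x y b} → LCA t x y b → x ∈ leaves t × y ∈ leaves t
  LCA⇒∈leaves {node _ cs} (here i j _ x∈ y∈) = ∈-leaves-lookup⁺ cs i x∈ , ∈-leaves-lookup⁺ cs j y∈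
  LCA⇒∈leaves (there c∈ l) = ∈-leavesL⁺ c∈ (proj₁ (LCA⇒∈leaves l)) , ∈-leavesL⁺ c∈ (proj₂ (LCA⇒∈leaves l))

  LCA⇒≢ : ∀ {t : Tree n} {x y b} → Unique (leaves t) → LCA t x y b → x ≢ y
  LCA⇒≢ {node _ cs} u (here i j i≢j x∈ y∈) refl = leaves-lookup-disjoint cs u i≢j x∈ y∈
  LCA⇒≢ u (there c∈ l) = LCA⇒≢ (Unique-leaves-child u c∈) l

  LCA-functional : ∀ {t : Tree n} {x y b b′} → Unique (leaves t) → LCA t x y b → LCA t x y b′ → b ≡ b′
  LCA-functional u (here _ _ _ _ _) (here _ _ _ _ _) = refl
  LCA-functional {node _ cs} u (here i j i≢j x∈ y∈) (there c∈ l) = ⊥-elim (here-there cs u i≢j x∈ y∈ c∈ l)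
    where
    here-there : ∀ cs → Unique (leavesL cs) → ∀ {i j x y c b} → i ≢ j →
      x ∈ leaves (lookup cs i) → y ∈ leaves (lookup cs j) → c ∈ cs → LCA c x y b → ⊥
    here-there cs u {i} {j} i≢j x∈ y∈ c∈ l with LCA⇒∈leaves l | i Fin.≟ index c∈
    ... | x∈c , _ | no i≢c = leaves-lookup-disjoint cs u i≢c x∈ (∈-leaves-index c∈ x∈c)
    ... | _ , y∈c | yes refl = leaves-lookup-disjoint cs u (i≢j ∘ sym) y∈ (∈-leaves-index c∈ y∈c)
  LCA-functional u l@(there _ _) l′@(here _ _ _ _ _) = sym (LCA-functional u l′ l)
  LCA-functional {node _ cs} u (there {c = c} c∈ l) (there {c = c′} c′∈ l′)
    with index c∈ Fin.≟ index c′∈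
  ... | no c≢c′ = ⊥-elim (leaves-lookup-disjoint cs u c≢c′
                    (∈-leaves-index c∈ (proj₁ (LCA⇒∈leaves l))) (∈-leaves-index c′∈ (proj₁ (LCA⇒∈leaves l′))))
  ... | yes c≡c′ = LCA-functional (Unique-leaves-child u c∈) l (subst (λ t → LCA t _ _ _) (sym c≡c′′) l′)
    where
    c≡c′′ : c ≡ c′
    c≡c′′ = trans (Any.lookup-index c∈) (trans (cong (lookup cs) c≡c′) (sym (Any.lookup-index c′∈)))

  LCA-∷ : ∀ {b b′} {c : Tree n} {cs x y} → LCA (node b cs) x y b′ → LCA (node b (c ∷ cs)) x y b′
  LCA-∷ (here i j i≢j x∈ y∈) = here (suc i) (suc j) (i≢j ∘ Fin.suc-injective) x∈ y∈
  LCA-∷ (there c∈ l) = there (there c∈) l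

  LCA-siblings : ∀ b (cs : List (Tree n)) →
    AllPairs (λ c c′ → ∀ {x y} → x ∈ leaves c → y ∈ leaves c′ → LCA (node b cs) x y b) cs
  LCA-siblings b [] = []
  LCA-siblings b (c ∷ cs) =
    All.tabulate (λ c′∈ {_} {_} x∈ y∈ → here zero (suc (index c′∈)) (λ ()) x∈ (∈-leaves-index c′∈ y∈))
    ∷ AllPairs.map (λ sib {_} {_} x∈ y∈ → LCA-∷ {c = c} (sib x∈ y∈)) (LCA-siblings b cs)

  LCA-partner : ∀ {b cs x} → WellFormed (node b cs) → x ∈ leavesL cs → ∃[ z ] LCA (node b cs) x z b
  LCA-partner {cs = c₀ ∷ c₁ ∷ cs} (wf-node _ _ _ _ (wf₀ ∷ wf₁ ∷ _)) x∈
    with ∈-leaves-lookup⁻ (c₀ ∷ c₁ ∷ cs) x∈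
  ... | zero , x∈c₀ with z , z∈ ← leaves-nonempty wf₁ = z , here zero (suc zero) (λ ()) x∈c₀ z∈
  ... | suc i , x∈cᵢ with z , z∈ ← leaves-nonempty wf₀ = z , here (suc i) zero (λ ()) x∈cᵢ z∈
  LCA-partner {cs = []} (wf-node _ _ () _ _) _
  LCA-partner {cs = _ ∷ []} (wf-node _ _ (s≤s ()) _ _) _

  mutual
    LCA-exists : ∀ (t : Tree n) {x y} → x ≢ y → x ∈ leaves t → y ∈ leaves t → ∃[ b ] LCA t x y b
    LCA-exists (leaf v) x≢y (here refl) (here refl) = ⊥-elim (x≢y refl)
    LCA-exists (node b cs) x≢y x∈ y∈ with LCA-exists-children cs x≢y x∈ y∈
    ... | inj₁ (i , j , i≢j , x∈cᵢ , y∈cⱼ) = b , here i j i≢j x∈cᵢ y∈cⱼ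
    ... | inj₂ (b′ , c , c∈ , l) = b′ , there c∈ l

    LCA-exists-children : ∀ (cs : List (Tree n)) {x y} → x ≢ y → x ∈ leavesL cs → y ∈ leavesL cs →
      (∃₂ λ i j → i ≢ j × x ∈ leaves (lookup cs i) × y ∈ leaves (lookup cs j))
      ⊎ (∃₂ λ b c → c ∈ cs × LCA c x y b)
    LCA-exists-children (c ∷ cs) x≢y x∈ y∈ with ∈-++⁻ (leaves c) x∈ | ∈-++⁻ (leaves c) y∈
    ... | inj₁ x∈c | inj₁ y∈c with b , l ← LCA-exists c x≢y x∈c y∈c = inj₂ (b , c , here refl , l)
    ... | inj₁ x∈c | inj₂ y∈cs with j , y∈cⱼ ← ∈-leaves-lookup⁻ cs y∈cs =
      inj₁ (zero , suc j , (λ ()) , x∈c , y∈cⱼ)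
    ... | inj₂ x∈cs | inj₁ y∈c with i , x∈cᵢ ← ∈-leaves-lookup⁻ cs x∈cs =
      inj₁ (suc i , zero , (λ ()) , x∈cᵢ , y∈c)
    ... | inj₂ x∈cs | inj₂ y∈cs with LCA-exists-children cs x≢y x∈cs y∈cs
    ...   | inj₁ (i , j , i≢j , x∈cᵢ , y∈cⱼ) = inj₁ (suc i , suc j , i≢j ∘ Fin.suc-injective , x∈cᵢ , y∈cⱼ)
    ...   | inj₂ (b , c′ , c′∈ , l) = inj₂ (b , c′ , there c′∈ , l)

true≢false : true ≢ false
true≢false ()

leafChildren : ∀ {n} → List (Tree n) → List (Fin n)
leafChildren [] = []
leafChildren (leaf v ∷ cs) = v ∷ leafChildren cs
leafChildren (node _ _ ∷ cs) = leafChildren cs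

length-leafChildren : ∀ {n} (cs : List (Tree n)) → length (leafChildren cs) ≡ countLeaves cs
length-leafChildren [] = refl
length-leafChildren (leaf v ∷ cs) = cong suc (length-leafChildren cs)
length-leafChildren (node _ _ ∷ cs) = length-leafChildren cs

∈-leafChildren : ∀ {n} {cs : List (Tree n)} {w} → leaf w ∈ cs → w ∈ leafChildren cs
∈-leafChildren (here refl) = here refl
∈-leafChildren {cs = leaf _ ∷ _} (there w∈) = there (∈-leafChildren w∈)
∈-leafChildren {cs = node _ _ ∷ _} (there w∈) = ∈-leafChildren w∈

module OrderProperties {n : ℕ} (P : FinPoset n) where

  infix 4 _⊏_
  _⊏_ : Fin n → Fin n → Set
  _⊏_ = Lt P

  ⊏-trans : ∀ {u v w} → u ⊏ v → v ⊏ w → u ⊏ w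
  ⊏-trans (u≼v , u≢v) (v≼w , _) =
    trans≼ P u≼v v≼w , λ { refl → u≢v (antisym≼ P u≼v v≼w) }

  ⊏-isStrictPartialOrder : IsStrictPartialOrder _≡_ _⊏_
  ⊏-isStrictPartialOrder = record
    { isEquivalence = isEquivalence
    ; irrefl = λ { refl (_ , u≢u) → u≢u refl }
    ; trans = ⊏-trans
    ; <-resp-≈ = (λ { refl u⊏v → u⊏v }) , (λ { refl u⊏v → u⊏v })
    }

  Between : Fin n → Fin n → Set
  Between u v = ∃[ w ] u ⊏ w × w ⊏ v

  Far : Fin n → Fin n → Set
  Far u v = Between u v ⊎ Between v u

  Middle : Fin n → Set
  Middle w = ∃₂ λ u v → u ⊏ w × w ⊏ v

  Far⇒Middle : ∀ {u v} → Far u v → ∃ Middle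
  Far⇒Middle (inj₁ (w , u⊏w , w⊏v)) = w , _ , _ , u⊏w , w⊏v
  Far⇒Middle (inj₂ (w , v⊏w , w⊏u)) = w , _ , _ , v⊏w , w⊏u

  CIEdge-sym : ∀ {u v} → CIEdge P u v → CIEdge P v u
  CIEdge-sym (inj₁ u⋖v) = inj₂ (inj₁ u⋖v)
  CIEdge-sym (inj₂ (inj₁ v⋖u)) = inj₁ v⋖u
  CIEdge-sym (inj₂ (inj₂ (u⋠v , v⋠u))) = inj₂ (inj₂ (v⋠u , u⋠v))

  CIEdge-irrefl : ∀ {u} → ¬ CIEdge P u u
  CIEdge-irrefl (inj₁ ((_ , u≢u) , _)) = u≢u refl
  CIEdge-irrefl (inj₂ (inj₁ ((_ , u≢u) , _))) = u≢u refl
  CIEdge-irrefl (inj₂ (inj₂ (u⋠u , _))) = u⋠u (refl≼ P)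

  Between⇒¬CIEdge : ∀ {u v} → Between u v → ¬ CIEdge P u v
  Between⇒¬CIEdge between (inj₁ (_ , ¬between)) = ¬between between
  Between⇒¬CIEdge (_ , u⊏w , w⊏v) (inj₂ (inj₁ ((v≼u , _) , _))) =
    proj₂ (⊏-trans u⊏w w⊏v) (antisym≼ P (proj₁ (⊏-trans u⊏w w⊏v)) v≼u)
  Between⇒¬CIEdge (_ , u⊏w , w⊏v) (inj₂ (inj₂ (u⋠v , _))) = u⋠v (proj₁ (⊏-trans u⊏w w⊏v))

ciGraph : ∀ {n} → FinPoset n → Graph n
ciGraph P = record { Adj = CIEdge P ; sym = CIEdge-sym ; irrefl = CIEdge-irrefl }
  where open OrderProperties P

module DecidableOrder {n : ℕ} (P : FinPoset n) (_≼?_ : Decidable (_≼_ P)) where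
  open OrderProperties P

  _⊏?_ : Decidable _⊏_
  u ⊏? v with u ≼? v | u Fin.≟ v
  ... | yes u≼v | no u≢v = yes (u≼v , u≢v)
  ... | yes _ | yes u≡v = no λ u⊏v → proj₂ u⊏v u≡v
  ... | no u⋠v | _ = no λ u⊏v → u⋠v (proj₁ u⊏v)

  ⊏⇒⋖⊎Between : ∀ {u v} → u ⊏ v → Covers P u v ⊎ Between u v
  ⊏⇒⋖⊎Between {u} {v} u⊏v with Fin.any? (λ w → (u ⊏? w) ×-dec (w ⊏? v))
  ... | yes between = inj₂ between
  ... | no ¬between = inj₁ (u⊏v , ¬between)

  ¬CIEdge⇒Far : ∀ {u v} → u ≢ v → ¬ CIEdge P u v → Far u v
  ¬CIEdge⇒Far {u} {v} u≢v ¬e with u ≼? v | v ≼? u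
  ... | yes u≼v | _ = [ ⊥-elim ∘ ¬e ∘ inj₁ , inj₁ ]′ (⊏⇒⋖⊎Between (u≼v , u≢v))
  ... | no _ | yes v≼u = [ ⊥-elim ∘ ¬e ∘ inj₂ ∘ inj₁ , inj₂ ]′ (⊏⇒⋖⊎Between (v≼u , u≢v ∘ sym))
  ... | no u⋠v | no v⋠u = ⊥-elim (¬e (inj₂ (inj₂ (u⋠v , v⋠u))))

-- Posets whose C-I graph is a cograph have height at most three

module HeightAtMostThree {n : ℕ} (P : FinPoset n) (_≼?_ : Decidable (_≼_ P))
                         (cograph : IsCograph (ciGraph P)) where
  open OrderProperties P
  open DecidableOrder P _≼?_

  ¬⋖-chain₄ : ∀ {a b c d} → Covers P a b → Covers P b c → Covers P c d → ⊥
  ¬⋖-chain₄ {a} {b} {c} {d} a⋖b@(a⊏b , _) b⋖c@(b⊏c , _) c⋖d@(c⊏d , _) = cograph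
    ( a , b , c , d
    , (proj₂ a⊏b , proj₂ (⊏-trans a⊏b b⊏c) , proj₂ (⊏-trans a⊏b b⊏d) , proj₂ b⊏c , proj₂ b⊏d , proj₂ c⊏d)
    , (inj₁ a⋖b , inj₁ b⋖c , inj₁ c⋖d)
    , (Between⇒¬CIEdge (b , a⊏b , b⊏c) , Between⇒¬CIEdge (b , a⊏b , b⊏d) , Between⇒¬CIEdge (c , b⊏c , c⊏d)))
    where
    b⊏d : b ⊏ d
    b⊏d = ⊏-trans b⊏c c⊏d

  -- Every chain of four elements refines to one of four covers: induction on the top
  -- element downwards and, for a fixed top, on the bottom element upwards.
  ¬⊏-chain₄ : ∀ {a b c d} → a ⊏ b → b ⊏ c → c ⊏ d → ⊥
  ¬⊏-chain₄ {d = d} = below d (spo-wellFounded ⊏-isStrictPartialOrder d) _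
    where
    below : ∀ d → Acc _⊏_ d → ∀ a {b c} → a ⊏ b → b ⊏ c → c ⊏ d → ⊥
    below d (acc below-d) a = above a (spo-noetherian ⊏-isStrictPartialOrder a)
      where
      above : ∀ a → Acc (flip _⊏_) a → ∀ {b c} → a ⊏ b → b ⊏ c → c ⊏ d → ⊥
      above a (acc above-a) {b} {c} a⊏b b⊏c c⊏d
        with ⊏⇒⋖⊎Between a⊏b | ⊏⇒⋖⊎Between b⊏c | ⊏⇒⋖⊎Between c⊏d
      ... | inj₂ (x , a⊏x , x⊏b) | _ | _ = above x (above-a a⊏x) x⊏b b⊏c c⊏d
      ... | inj₁ _ | inj₂ (x , b⊏x , x⊏c) | _ = below c (below-d c⊏d) a a⊏b b⊏x x⊏c
      ... | inj₁ _ | inj₁ _ | inj₂ (x , c⊏x , x⊏d) = above b (above-a a⊏b) b⊏c c⊏x x⊏d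
      ... | inj₁ a⋖b | inj₁ b⋖c | inj₁ c⋖d = ¬⋖-chain₄ a⋖b b⋖c c⋖d

  ¬Between-chain : ∀ {u v w} → Between u v → Between v w → ⊥
  ¬Between-chain (_ , _ , x⊏v) (_ , v⊏y , y⊏w) = ¬⊏-chain₄ x⊏v v⊏y y⊏w

  -- of three pairwise far elements, one lies far above one and far below another
  ¬Far-triple : ∀ {x y z} → Far x y → Far x z → Far y z → ⊥
  ¬Far-triple (inj₁ xy) _ (inj₁ yz) = ¬Between-chain xy yz
  ¬Far-triple (inj₁ xy) (inj₁ xz) (inj₂ zy) = ¬Between-chain xz zy
  ¬Far-triple (inj₁ xy) (inj₂ zx) (inj₂ _) = ¬Between-chain zx xy
  ¬Far-triple (inj₂ yx) (inj₁ xz) _ = ¬Between-chain yx xz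
  ¬Far-triple (inj₂ yx) (inj₂ zx) (inj₁ yz) = ¬Between-chain yz zx
  ¬Far-triple (inj₂ yx) (inj₂ _) (inj₂ zy) = ¬Between-chain zy yx

  Middle⇒CIEdge : ∀ {w z} → Middle w → w ≢ z → CIEdge P w z
  Middle⇒CIEdge {w} {z} (x , y , x⊏w , w⊏y) w≢z with w ≼? z | z ≼? w
  ... | yes w≼z | _ = [ inj₁ , (λ { (m , w⊏m , m⊏z) → ⊥-elim (¬⊏-chain₄ x⊏w w⊏m m⊏z) }) ]′
                        (⊏⇒⋖⊎Between (w≼z , w≢z))
  ... | no _ | yes z≼w = [ inj₂ ∘ inj₁ , (λ { (m , z⊏m , m⊏w) → ⊥-elim (¬⊏-chain₄ z⊏m m⊏w w⊏y) }) ]′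
                           (⊏⇒⋖⊎Between (z≼w , w≢z ∘ sym))
  ... | no w⋠z | no z⋠w = inj₂ (inj₂ (w⋠z , z⋠w))

-- The cotree of a cograph C-I graph lies in 𝒯_C

module CotreeOfCIGraph {n : ℕ} (P : FinPoset n) (_≼?_ : Decidable (_≼_ P))
                       (cograph : IsCograph (ciGraph P)) where
  open OrderProperties P
  open DecidableOrder P _≼?_
  open HeightAtMostThree P _≼?_ cograph

  module Cotree {T : Tree n} (uq : Unique (leaves T))
                (adj : ∀ x y → x ≢ y → (CIEdge P x y ⇔ LCA T x y true)) where

    LCA-true⇒CIEdge : ∀ {x y} → LCA T x y true → CIEdge P x y
    LCA-true⇒CIEdge l = Equivalence.from (adj _ _ (LCA⇒≢ uq l)) l

    LCA-false⇒¬CIEdge : ∀ {x y} → LCA T x y false → ¬ CIEdge P x y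
    LCA-false⇒¬CIEdge l e = true≢false (LCA-functional uq (Equivalence.to (adj _ _ (LCA⇒≢ uq l)) e) l)

    LCA-false⇒Far : ∀ {x y} → LCA T x y false → Far x y
    LCA-false⇒Far l = ¬CIEdge⇒Far (LCA⇒≢ uq l) (LCA-false⇒¬CIEdge l)

    Middle⇒¬LCA-false : ∀ {w z} → Middle w → ¬ LCA T w z false
    Middle⇒¬LCA-false middle l = LCA-false⇒¬CIEdge l (Middle⇒CIEdge middle (LCA⇒≢ uq l))

    ¬LCA-false-triple : ∀ {x y z} → LCA T x y false → LCA T x z false → LCA T y z false → ⊥
    ¬LCA-false-triple xy xz yz = ¬Far-triple (LCA-false⇒Far xy) (LCA-false⇒Far xz) (LCA-false⇒Far yz)

  ¬cotree-0-root : ∀ {cs} → ¬ IsCotreeOf (ciGraph P) (node false cs)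
  ¬cotree-0-root (wf , uq , all∈ , adj) =
    Middle⇒¬LCA-false (proj₂ middle) (proj₂ (LCA-partner wf (all∈ (proj₁ middle))))
    where
    open Cotree uq adj
    middle : ∃ Middle
    middle = Far⇒Middle (LCA-false⇒Far (proj₂ (LCA-partner wf (proj₂ (leaves-nonempty wf)))))

  module OneNodeRoot {cs : List (Tree n)} (oks : All (ChildOk true) cs) (wfs : All WellFormed cs)
                     (uq : Unique (leavesL cs)) (all∈ : ∀ v → v ∈ leavesL cs)
                     (adj : ∀ x y → x ≢ y → (CIEdge P x y ⇔ LCA (node true cs) x y true)) where
    open Cotree uq adj

    T : Tree n
    T = node true cs

    -- y is a vertex below the sibling of d, hence non-adjacent to all of d: a 0-node
    -- below d would complete an independent triple.
    grandchild-shape : ∀ {d y} → WellFormed d → ChildOk false d →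
      (∀ {z z′} → LCA d z z′ false → LCA T z z′ false) →
      (∀ {z} → z ∈ leaves d → LCA T z y false) → IsLeaf d ⊎ Inner1 d
    grandchild-shape (wf-leaf _) _ _ _ = inj₁ tt
    grandchild-shape {node true es} (wf-node _ _ _ oks′ wfs′) _ lift across =
      inj₂ (All.tabulate λ e∈ → leaf-child e∈ (All.lookup wfs′ e∈) (All.lookup oks′ e∈))
      where
      leaf-child : ∀ {e} → e ∈ es → WellFormed e → ChildOk true e → IsLeaf e
      leaf-child {leaf _} _ _ _ = tt
      leaf-child {node false _} e∈ wf _ with z , z∈ ← leaves-nonempty wf
        with z′ , z-z′ ← LCA-partner wf z∈
        = ¬LCA-false-triple (lift (there e∈ z-z′)) (across (∈-leavesL⁺ e∈ z∈))
                            (across (∈-leavesL⁺ e∈ (proj₂ (LCA⇒∈leaves z-z′))))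

    zero-child-shape : ∀ {ds} → node false ds ∈ cs → WellFormed (node false ds) → Zero2 (node false ds)
    zero-child-shape {d₀ ∷ d₁ ∷ []} c∈ (wf-node _ _ _ (ok₀ ∷ ok₁ ∷ []) (wf₀ ∷ wf₁ ∷ [])) =
      grandchild-shape wf₀ ok₀ (λ l → there c∈ (there (here refl) l))
        (λ z∈ → there c∈ (here zero (suc zero) (λ ()) z∈ (proj₂ (leaves-nonempty wf₁)))) ,
      grandchild-shape wf₁ ok₁ (λ l → there c∈ (there (there (here refl)) l))
        (λ z∈ → there c∈ (here (suc zero) zero (λ ()) z∈ (proj₂ (leaves-nonempty wf₀))))
    zero-child-shape {d₀ ∷ d₁ ∷ d₂ ∷ _} c∈ (wf-node _ _ _ _ (wf₀ ∷ wf₁ ∷ wf₂ ∷ _))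
      with _ , x₀ ← leaves-nonempty wf₀ | _ , x₁ ← leaves-nonempty wf₁ | _ , x₂ ← leaves-nonempty wf₂ =
      ⊥-elim (¬LCA-false-triple (there c∈ (here zero (suc zero) (λ ()) x₀ x₁))
                                (there c∈ (here zero (suc (suc zero)) (λ ()) x₀ x₂))
                                (there c∈ (here (suc zero) (suc (suc zero)) (λ ()) x₁ x₂)))
    zero-child-shape {[]} _ (wf-node _ _ () _ _)
    zero-child-shape {_ ∷ []} _ (wf-node _ _ (s≤s ()) _ _)

    children-shape : All (λ c → IsLeaf c ⊎ Zero2 c) cs
    children-shape = All.tabulate λ c∈ → shape c∈ (All.lookup oks c∈) (All.lookup wfs c∈)
      where
      shape : ∀ {c} → c ∈ cs → ChildOk true c → WellFormed c → IsLeaf c ⊎ Zero2 c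
      shape {leaf _} _ _ _ = inj₁ tt
      shape {node false _} c∈ _ wf = inj₂ (zero-child-shape c∈ wf)

    Middle⇒leaf-child : ∀ {w} → Middle w → leaf w ∈ cs
    Middle⇒leaf-child {w} middle with ∈-leavesL⁻ cs (all∈ w)
    ... | leaf _ , c∈ , here refl = c∈
    ... | node false _ , c∈ , w∈ =
      ⊥-elim (Middle⇒¬LCA-false middle (there c∈ (proj₂ (LCA-partner (All.lookup wfs c∈) w∈))))
    ... | node true _ , c∈ , _ with () ← All.lookup oks c∈

    Serves : Fin n → Tree n → Set
    Serves w c = ∃₂ λ a b → a ∈ leaves c × b ∈ leaves c × a ⊏ w × w ⊏ b

    ServedChild : Tree n → Set
    ServedChild (leaf _) = ⊤
    ServedChild (node true _) = ⊥
    ServedChild (node false ds) = ∃[ w ] leaf w ∈ cs × Serves w (node false ds)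

    served : ∀ {ds} → node false ds ∈ cs → WellFormed (node false ds) → ServedChild (node false ds)
    served c∈ wf
      with x , x∈ ← leaves-nonempty wf
      with z , x-z ← LCA-partner wf x∈
      with LCA-false⇒Far (there c∈ x-z) | LCA⇒∈leaves x-z
    ... | inj₁ (m , x⊏m , m⊏z) | x∈c , z∈c =
      m , Middle⇒leaf-child (_ , _ , x⊏m , m⊏z) , x , z , x∈c , z∈c , x⊏m , m⊏z
    ... | inj₂ (m , z⊏m , m⊏x) | x∈c , z∈c =
      m , Middle⇒leaf-child (_ , _ , z⊏m , m⊏x) , z , x , z∈c , x∈c , z⊏m , m⊏x

    servedChildren : All ServedChild cs
    servedChildren = All.tabulate λ c∈ → serve c∈ (All.lookup oks c∈) (All.lookup wfs c∈)
      where
      serve : ∀ {c} → c ∈ cs → ChildOk true c → WellFormed c → ServedChild c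
      serve {leaf _} _ _ _ = tt
      serve {node false _} c∈ _ wf = served c∈ wf

    witnesses : ∀ {cs′} → All ServedChild cs′ → List (Fin n)
    witnesses [] = []
    witnesses {leaf _ ∷ _} (_ ∷ sv) = witnesses sv
    witnesses {node false _ ∷ _} ((w , _) ∷ sv) = w ∷ witnesses sv

    length-witnesses : ∀ {cs′} (sv : All ServedChild cs′) → length (witnesses sv) ≡ countZeroNodes cs′
    length-witnesses [] = refl
    length-witnesses {leaf _ ∷ _} (_ ∷ sv) = length-witnesses sv
    length-witnesses {node false _ ∷ _} (_ ∷ sv) = cong suc (length-witnesses sv)

    witnesses⊆leafChildren : ∀ {cs′} (sv : All ServedChild cs′) → All (_∈ leafChildren cs) (witnesses sv)
    witnesses⊆leafChildren [] = []
    witnesses⊆leafChildren {leaf _ ∷ _} (_ ∷ sv) = witnesses⊆leafChildren sv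
    witnesses⊆leafChildren {node false _ ∷ _} ((_ , w∈ , _) ∷ sv) =
      ∈-leafChildren w∈ ∷ witnesses⊆leafChildren sv

    witnesses-serve : ∀ {cs′} (sv : All ServedChild cs′) →
      All (λ w → ∃[ c ] c ∈ cs′ × Serves w c) (witnesses sv)
    witnesses-serve [] = []
    witnesses-serve {leaf _ ∷ _} (_ ∷ sv) = All.map (λ (c , c∈ , s) → c , there c∈ , s) (witnesses-serve sv)
    witnesses-serve {node false _ ∷ _} ((_ , _ , s) ∷ sv) =
      (_ , here refl , s) ∷ All.map (λ (c , c∈ , s) → c , there c∈ , s) (witnesses-serve sv)

    CrossAdjacent : Tree n → Tree n → Set
    CrossAdjacent c c′ = ∀ {a b} → a ∈ leaves c → b ∈ leaves c′ → CIEdge P a b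

    -- a vertex serving two children would put a vertex of the one below a vertex of the other
    witnesses-unique : ∀ {cs′} (sv : All ServedChild cs′) → AllPairs CrossAdjacent cs′ →
      Unique (witnesses sv)
    witnesses-unique [] [] = []
    witnesses-unique {leaf _ ∷ _} (_ ∷ sv) (_ ∷ cross) = witnesses-unique sv cross
    witnesses-unique {node false _ ∷ _} ((w , _ , _ , _ , a∈ , _ , a⊏w , _) ∷ sv) (cross₀ ∷ cross) =
      All.map distinct (witnesses-serve sv) ∷ witnesses-unique sv cross
      where
      distinct : ∀ {w′} → ∃[ c ] c ∈ _ × Serves w′ c → w ≢ w′
      distinct (_ , c∈ , _ , _ , _ , b∈ , _ , w⊏b) refl =
        Between⇒¬CIEdge (w , a⊏w , w⊏b) (All.lookup cross₀ c∈ a∈ b∈)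

    countZeroNodes≤countLeaves : countZeroNodes cs ≤ countLeaves cs
    countZeroNodes≤countLeaves =
      subst₂ _≤_ (length-witnesses servedChildren) (length-leafChildren cs)
        (Unique⇒length≤ (witnesses-unique servedChildren siblings) (witnesses⊆leafChildren servedChildren))
      where
      siblings : AllPairs CrossAdjacent cs
      siblings = AllPairs.map (λ sib {_} {_} a∈ b∈ → LCA-true⇒CIEdge (sib a∈ b∈)) (LCA-siblings true cs)

  cotree-InTC : ∀ {T} → IsCotreeOf (ciGraph P) T → InTC T
  cotree-InTC {leaf _} _ = tt
  cotree-InTC {node false _} cotree = ⊥-elim (¬cotree-0-root cotree)
  cotree-InTC {node true _} (wf-node _ _ _ oks wfs , uq , all∈ , adj) =
    children-shape , countZeroNodes≤countLeaves
    where open OneNodeRoot oks wfs uq all∈ adj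

-- A poset for every tree of 𝒯_C

module _ {n : ℕ} where

  countZeroNodes-++ : ∀ (xs ys : List (Tree n)) →
    countZeroNodes (xs ++ ys) ≡ countZeroNodes xs + countZeroNodes ys
  countZeroNodes-++ [] ys = refl
  countZeroNodes-++ (leaf _ ∷ xs) ys = countZeroNodes-++ xs ys
  countZeroNodes-++ (node true _ ∷ xs) ys = countZeroNodes-++ xs ys
  countZeroNodes-++ (node false _ ∷ xs) ys = cong suc (countZeroNodes-++ xs ys)

  split-unique : ∀ (pre pre′ : List (Tree n)) {c c′ post post′ x} →
    Unique (leavesL (pre ++ c ∷ post)) → pre ++ c ∷ post ≡ pre′ ++ c′ ∷ post′ →
    x ∈ leaves c → x ∈ leaves c′ → pre ≡ pre′ × c ≡ c′
  split-unique [] [] _ e _ _ = refl , List.∷-injectiveˡ e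
  split-unique [] (_ ∷ pre′) {c} u e x∈c x∈c′ =
    ⊥-elim (proj₂ (proj₂ (Unique-++⁻ (leaves c) _ u)) x∈c
      (subst (λ cs → _ ∈ leavesL cs) (sym (List.∷-injectiveʳ e))
        (∈-leavesL⁺ (∈-++⁺ʳ pre′ (here refl)) x∈c′)))
  split-unique (d ∷ pre) [] u e x∈c x∈c′ =
    ⊥-elim (proj₂ (proj₂ (Unique-++⁻ (leaves d) _ u))
      (subst (λ c → _ ∈ leaves c) (sym (List.∷-injectiveˡ e)) x∈c′)
      (∈-leavesL⁺ (∈-++⁺ʳ pre (here refl)) x∈c))
  split-unique (d ∷ pre) (_ ∷ pre′) u e x∈c x∈c′ with refl , e′ ← List.∷-injective e
    with refl , c≡c′ ← split-unique pre pre′ (proj₁ (proj₂ (Unique-++⁻ (leaves d) _ u))) e′ x∈c x∈c′ =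
    refl , c≡c′

  zero-node-unique : ∀ (pre pre′ : List (Tree n)) {ds ds′ post post′} →
    pre ++ node false ds ∷ post ≡ pre′ ++ node false ds′ ∷ post′ →
    countZeroNodes pre ≡ countZeroNodes pre′ → ds ≡ ds′
  zero-node-unique [] [] e _ with refl ← List.∷-injectiveˡ e = refl
  zero-node-unique [] (_ ∷ _) e #≡ with refl ← List.∷-injectiveˡ e with () ← #≡
  zero-node-unique (_ ∷ _) [] e #≡ with refl ← List.∷-injectiveˡ e with () ← #≡
  zero-node-unique (d ∷ pre) (_ ∷ pre′) e #≡ with refl ← List.∷-injectiveˡ e =
    zero-node-unique pre pre′ (List.∷-injectiveʳ e) (#≡-tail d #≡)
    where
    #≡-tail : ∀ d → countZeroNodes (d ∷ pre) ≡ countZeroNodes (d ∷ pre′) →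
      countZeroNodes pre ≡ countZeroNodes pre′
    #≡-tail (leaf _) #≡ = #≡
    #≡-tail (node true _) #≡ = #≡
    #≡-tail (node false _) #≡ = ℕ.suc-injective #≡

  leaf-child-at : ∀ (cs : List (Tree n)) k → k < countLeaves cs →
    ∃ λ pre → ∃₂ λ v post → cs ≡ pre ++ leaf v ∷ post × countLeaves pre ≡ k
  leaf-child-at (leaf v ∷ cs) zero _ = [] , v , cs , refl , refl
  leaf-child-at (leaf u ∷ cs) (suc k) (s≤s k<) with pre , v , post , e , #≡ ← leaf-child-at cs k k< =
    leaf u ∷ pre , v , post , cong (leaf u ∷_) e , cong suc #≡
  leaf-child-at (node b ds ∷ cs) k k< with pre , v , post , e , #≡ ← leaf-child-at cs k k< =
    node b ds ∷ pre , v , post , cong (node b ds ∷_) e , #≡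

a<b<c≤2⇒a≡0×c≡2 : ∀ {a b c} → a < b → b < c → c ≤ 2 → a ≡ 0 × c ≡ 2
a<b<c≤2⇒a≡0×c≡2 (s≤s z≤n) (s≤s (s≤s z≤n)) (s≤s (s≤s z≤n)) = refl , refl

-- The k-th 0-node child {A, B} and the k-th leaf child ℓ of the root form group k,
-- with A, ℓ, B at levels 0, 1, 2.
module CIPoset {n : ℕ} {cs : List (Tree n)} (shape : All (λ c → IsLeaf c ⊎ Zero2 c) cs)
               (balanced : countZeroNodes cs ≤ countLeaves cs) (uq : Unique (leavesL cs))
               (all∈ : ∀ v → v ∈ leavesL cs) where

  T : Tree n
  T = node true cs

  split⇒∈ : ∀ {pre c post} → cs ≡ pre ++ c ∷ post → c ∈ cs
  split⇒∈ {pre} e = subst (_ ∈_) (sym e) (∈-++⁺ʳ pre (here refl))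

  same-split : ∀ {pre c post pre′ c′ post′ x} → cs ≡ pre ++ c ∷ post → cs ≡ pre′ ++ c′ ∷ post′ →
    x ∈ leaves c → x ∈ leaves c′ → pre ≡ pre′ × c ≡ c′
  same-split {pre} {pre′ = pre′} e e′ =
    split-unique pre pre′ (subst (λ cs → Unique (leavesL cs)) e uq) (trans (sym e) e′)

  sides-disjoint : ∀ {pre a b post x} → cs ≡ pre ++ node false (a ∷ b ∷ []) ∷ post →
    x ∈ leaves a → x ∈ leaves b → ⊥
  sides-disjoint {a = a} e x∈a x∈b =
    proj₂ (proj₂ (Unique-++⁻ (leaves a) _ (Unique-leaves-child uq (split⇒∈ e)))) x∈a (∈-++⁺ˡ x∈b)

  data Position (x : Fin n) : Set where
    leafChild : ∀ pre post → cs ≡ pre ++ leaf x ∷ post → Position x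
    lowerSide : ∀ pre {a b} post → cs ≡ pre ++ node false (a ∷ b ∷ []) ∷ post → x ∈ leaves a → Position x
    upperSide : ∀ pre {a b} post → cs ≡ pre ++ node false (a ∷ b ∷ []) ∷ post → x ∈ leaves b → Position x

  classify : ∀ {x} pre {c} post → cs ≡ pre ++ c ∷ post → x ∈ leaves c → IsLeaf c ⊎ Zero2 c → Position x
  classify pre {leaf _} post e (here refl) _ = leafChild pre post e
  classify pre {node false (a ∷ b ∷ [])} post e x∈ _ with ∈-++⁻ (leaves a) x∈
  ... | inj₁ x∈a = lowerSide pre post e x∈a
  ... | inj₂ x∈b with ∈-++⁻ (leaves b) x∈b
  ...   | inj₁ x∈b′ = upperSide pre post e x∈b′
  ...   | inj₂ ()
  classify _ {node _ _} _ _ _ (inj₁ ())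
  classify _ {node true _} _ _ _ (inj₂ ())
  classify _ {node false []} _ _ _ (inj₂ ())
  classify _ {node false (_ ∷ [])} _ _ _ (inj₂ ())
  classify _ {node false (_ ∷ _ ∷ _ ∷ _)} _ _ _ (inj₂ ())

  position : ∀ x → Position x
  position x with c , c∈ , x∈c ← ∈-leavesL⁻ cs (all∈ x) with pre , post , e ← ∈-∃++ c∈ =
    classify pre post e x∈c (All.lookup shape c∈)

  label : ∀ {x} → Position x → ℕ × ℕ
  label (leafChild pre _ _) = countLeaves pre , 1
  label (lowerSide pre _ _ _) = countZeroNodes pre , 0
  label (upperSide pre _ _ _) = countZeroNodes pre , 2

  prefix suffix : ∀ {x} → Position x → List (Tree n)
  prefix (leafChild pre _ _) = pre
  prefix (lowerSide pre _ _ _) = pre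
  prefix (upperSide pre _ _ _) = pre
  suffix (leafChild _ post _) = post
  suffix (lowerSide _ post _ _) = post
  suffix (upperSide _ post _ _) = post

  child : ∀ {x} → Position x → Tree n
  child {x} (leafChild _ _ _) = leaf x
  child (lowerSide _ {a} {b} _ _ _) = node false (a ∷ b ∷ [])
  child (upperSide _ {a} {b} _ _ _) = node false (a ∷ b ∷ [])

  child-split : ∀ {x} (p : Position x) → cs ≡ prefix p ++ child p ∷ suffix p
  child-split (leafChild _ _ e) = e
  child-split (lowerSide _ _ e _) = e
  child-split (upperSide _ _ e _) = e

  ∈-child : ∀ {x} (p : Position x) → x ∈ leaves (child p)
  ∈-child (leafChild _ _ _) = here refl
  ∈-child (lowerSide _ _ _ x∈a) = ∈-++⁺ˡ x∈a
  ∈-child (upperSide _ {a} _ _ x∈b) = ∈-++⁺ʳ (leaves a) (∈-++⁺ˡ x∈b)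

  same-child : ∀ {x} (p q : Position x) → prefix p ≡ prefix q × child p ≡ child q
  same-child p q = same-split (child-split p) (child-split q) (∈-child p) (∈-child q)

  label-unique : ∀ {x} (p q : Position x) → label p ≡ label q
  label-unique p@(leafChild _ _ _) q@(leafChild _ _ _) with refl , _ ← same-child p q = refl
  label-unique p@(leafChild _ _ _) q@(lowerSide _ _ _ _) with _ , () ← same-child p q
  label-unique p@(leafChild _ _ _) q@(upperSide _ _ _ _) with _ , () ← same-child p q
  label-unique p@(lowerSide _ _ _ _) q@(leafChild _ _ _) with _ , () ← same-child p q
  label-unique p@(lowerSide _ _ _ _) q@(lowerSide _ _ _ _) with refl , _ ← same-child p q = refl
  label-unique p@(lowerSide _ _ e x∈a) q@(upperSide _ _ _ x∈b) with refl , refl ← same-child p q =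
    ⊥-elim (sides-disjoint e x∈a x∈b)
  label-unique p@(upperSide _ _ _ _) q@(leafChild _ _ _) with _ , () ← same-child p q
  label-unique p@(upperSide _ _ e x∈b) q@(lowerSide _ _ _ x∈a) with refl , refl ← same-child p q =
    ⊥-elim (sides-disjoint e x∈a x∈b)
  label-unique p@(upperSide _ _ _ _) q@(upperSide _ _ _ _) with refl , _ ← same-child p q = refl

  group level : Fin n → ℕ
  group x = proj₁ (label (position x))
  level x = proj₂ (label (position x))

  group-at : ∀ {x} (p : Position x) → group x ≡ proj₁ (label p)
  group-at p = cong proj₁ (label-unique (position _) p)

  level-at : ∀ {x} (p : Position x) → level x ≡ proj₂ (label p)
  level-at p = cong proj₂ (label-unique (position _) p)

  label≤2 : ∀ {x} (p : Position x) → proj₂ (label p) ≤ 2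
  label≤2 (leafChild _ _ _) = s≤s z≤n
  label≤2 (lowerSide _ _ _ _) = z≤n
  label≤2 (upperSide _ _ _ _) = s≤s (s≤s z≤n)

  level≤2 : ∀ x → level x ≤ 2
  level≤2 x = label≤2 (position x)

  zero-child<countLeaves : ∀ {pre ds post} → cs ≡ pre ++ node false ds ∷ post →
    countZeroNodes pre < countLeaves cs
  zero-child<countLeaves {pre} {ds} {post} e = begin-strict
    countZeroNodes pre                                          <⟨ ℕ.m<m+n _ (s≤s z≤n) ⟩
    countZeroNodes pre + countZeroNodes (node false ds ∷ post) ≡⟨ sym (countZeroNodes-++ pre _) ⟩
    countZeroNodes (pre ++ node false ds ∷ post)               ≡⟨ cong countZeroNodes (sym e) ⟩
    countZeroNodes cs                                           ≤⟨ balanced ⟩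
    countLeaves cs                                              ∎
    where open ℕ.≤-Reasoning

  middle-of-zero-child : ∀ {pre ds post} → cs ≡ pre ++ node false ds ∷ post →
    ∃[ w ] group w ≡ countZeroNodes pre × level w ≡ 1
  middle-of-zero-child e with pre , w , post , e′ , #≡ ← leaf-child-at cs _ (zero-child<countLeaves e) =
    w , trans (group-at (leafChild pre post e′)) #≡ , level-at (leafChild pre post e′)

  middle-at : ∀ {x} (p : Position x) → proj₂ (label p) ≢ 1 → ∃[ w ] group w ≡ proj₁ (label p) × level w ≡ 1
  middle-at (leafChild _ _ _) ≢1 = ⊥-elim (≢1 refl)
  middle-at (lowerSide _ _ e _) _ = middle-of-zero-child e
  middle-at (upperSide _ _ e _) _ = middle-of-zero-child e

  Sides : Fin n → Fin n → Set
  Sides x y = ∃ λ pre → ∃₂ λ a b → ∃ λ post →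
    cs ≡ pre ++ node false (a ∷ b ∷ []) ∷ post × x ∈ leaves a × y ∈ leaves b

  Opposite : Fin n → Fin n → Set
  Opposite x y = group x ≡ group y × level x ≡ 0 × level y ≡ 2

  Sides⇒Opposite : ∀ {x y} → Sides x y → Opposite x y
  Sides⇒Opposite {x} {y} (pre , a , b , post , e , x∈ , y∈) =
    trans (group-at lower) (sym (group-at upper)) , level-at lower , level-at upper
    where
    lower : Position x
    lower = lowerSide pre post e x∈
    upper : Position y
    upper = upperSide pre post e y∈

  Opposite⇒Sides : ∀ {x y} → Opposite x y → Sides x y
  Opposite⇒Sides {x} {y} = go (position x) (position y)
    where
    go : (p : Position x) (q : Position y) →
      proj₁ (label p) ≡ proj₁ (label q) × proj₂ (label p) ≡ 0 × proj₂ (label q) ≡ 2 → Sides x y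
    go (lowerSide pre post e x∈) (upperSide pre′ post′ e′ y∈) (#≡ , _ , _)
      with refl ← zero-node-unique pre pre′ (trans (sym e) e′) #≡ = pre , _ , _ , post , e , x∈ , y∈
    go (leafChild _ _ _) _ (_ , () , _)
    go (upperSide _ _ _ _) _ (_ , () , _)
    go (lowerSide _ _ _ _) (leafChild _ _ _) (_ , _ , ())
    go (lowerSide _ _ _ _) (lowerSide _ _ _ _) (_ , _ , ())

  Sides⇒LCA-false : ∀ {x y} → Sides x y ⊎ Sides y x → LCA T x y false
  Sides⇒LCA-false (inj₁ (_ , _ , _ , _ , e , x∈a , y∈b)) =
    there (split⇒∈ e) (here zero (suc zero) (λ ()) x∈a y∈b)
  Sides⇒LCA-false (inj₂ (_ , _ , _ , _ , e , y∈a , x∈b)) =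
    there (split⇒∈ e) (here (suc zero) zero (λ ()) x∈b y∈a)

  ¬LCA-false-below : ∀ {d : Tree n} {x y} → IsLeaf d ⊎ Inner1 d → ¬ LCA d x y false
  ¬LCA-false-below {leaf _} _ ()
  ¬LCA-false-below {node true es} (inj₂ leaf-children) (there e∈ l) =
    ¬LCA-leaf (All.lookup leaf-children e∈) l
    where
    ¬LCA-leaf : ∀ {e : Tree n} {x y} → IsLeaf e → ¬ LCA e x y false
    ¬LCA-leaf {leaf _} _ ()

  zero-child-sides : ∀ pre {c} post {x y} → cs ≡ pre ++ c ∷ post → IsLeaf c ⊎ Zero2 c →
    LCA c x y false → Sides x y ⊎ Sides y x
  zero-child-sides pre {node false (a ∷ b ∷ [])} post e _ (here zero (suc zero) _ x∈a y∈b) =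
    inj₁ (pre , a , b , post , e , x∈a , y∈b)
  zero-child-sides pre {node false (a ∷ b ∷ [])} post e _ (here (suc zero) zero _ x∈b y∈a) =
    inj₂ (pre , a , b , post , e , y∈a , x∈b)
  zero-child-sides _ {node false (_ ∷ _ ∷ [])} _ _ _ (here zero zero i≢i _ _) = ⊥-elim (i≢i refl)
  zero-child-sides _ {node false (_ ∷ _ ∷ [])} _ _ _ (here (suc zero) (suc zero) i≢i _ _) = ⊥-elim (i≢i refl)
  zero-child-sides _ {node false (_ ∷ _ ∷ [])} _ _ (inj₂ (a-shape , _)) (there (here refl) l) =
    ⊥-elim (¬LCA-false-below a-shape l)
  zero-child-sides _ {node false (_ ∷ _ ∷ [])} _ _ (inj₂ (_ , b-shape)) (there (there (here refl)) l) =
    ⊥-elim (¬LCA-false-below b-shape l)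
  zero-child-sides _ {leaf _} _ _ _ ()
  zero-child-sides _ {node _ _} _ _ (inj₁ ()) _
  zero-child-sides _ {node true _} _ _ (inj₂ ()) _
  zero-child-sides _ {node false []} _ _ (inj₂ ()) _
  zero-child-sides _ {node false (_ ∷ [])} _ _ (inj₂ ()) _
  zero-child-sides _ {node false (_ ∷ _ ∷ _ ∷ _)} _ _ (inj₂ ()) _

  LCA-false⇒Sides : ∀ {x y} → LCA T x y false → Sides x y ⊎ Sides y x
  LCA-false⇒Sides (there c∈ l) with pre , post , e ← ∈-∃++ c∈ =
    zero-child-sides pre post e (All.lookup shape c∈) l

  LCA-false⇔Opposite : ∀ {x y} → LCA T x y false ⇔ (Opposite x y ⊎ Opposite y x)
  LCA-false⇔Opposite = mk⇔ (Sum.map Sides⇒Opposite Sides⇒Opposite ∘ LCA-false⇒Sides)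
                           (Sides⇒LCA-false ∘ Sum.map Opposite⇒Sides Opposite⇒Sides)

  infix 4 _⊑_
  _⊑_ : Fin n → Fin n → Set
  x ⊑ y = x ≡ y ⊎ (group x ≡ group y × level x < level y)

  levelPoset : FinPoset n
  levelPoset = record
    { _≼_ = _⊑_
    ; refl≼ = inj₁ refl
    ; antisym≼ = λ { (inj₁ x≡y) _ → x≡y
                   ; (inj₂ _) (inj₁ y≡x) → sym y≡x
                   ; (inj₂ (_ , x<y)) (inj₂ (_ , y<x)) → ⊥-elim (ℕ.<-asym x<y y<x) }
    ; trans≼ = λ { (inj₁ refl) y⊑z → y⊑z
                 ; (inj₂ x⊏y) (inj₁ refl) → inj₂ x⊏y
                 ; (inj₂ (g₁ , l₁)) (inj₂ (g₂ , l₂)) → inj₂ (trans g₁ g₂ , ℕ.<-trans l₁ l₂) }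
    }

  open OrderProperties levelPoset using (_⊏_; Between⇒¬CIEdge; CIEdge-sym)

  ⊏-intro : ∀ {x y} → group x ≡ group y → level x < level y → x ⊏ y
  ⊏-intro g l = inj₂ (g , l) , λ { refl → ℕ.<-irrefl refl l }

  ⊏-elim : ∀ {x y} → x ⊏ y → group x ≡ group y × level x < level y
  ⊏-elim (inj₁ x≡y , x≢y) = ⊥-elim (x≢y x≡y)
  ⊏-elim (inj₂ g< , _) = g<

  ¬⊑ : ∀ {x y} → x ≢ y → ¬ (group x ≡ group y × level x < level y) → ¬ x ⊑ y
  ¬⊑ x≢y _ (inj₁ x≡y) = x≢y x≡y
  ¬⊑ _ ¬g< (inj₂ g<) = ¬g< g<

  Opposite⇒¬CIEdge : ∀ {x y} → Opposite x y → ¬ CIEdge levelPoset x y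
  Opposite⇒¬CIEdge {x} (g , lx , ly)
    with w , gw , lw ← middle-at (position x) (λ l → ℕ.0≢1+n (trans (sym lx) l)) =
    Between⇒¬CIEdge (w , ⊏-intro (sym gw) (subst₂ _<_ (sym lx) (sym lw) (s≤s z≤n))
                       , ⊏-intro (trans gw g) (subst₂ _<_ (sym lw) (sym ly) (s≤s (s≤s z≤n))))

  -- strictly between two vertices of one group there can only be a level-1 vertex
  covers : ∀ {x y} → group x ≡ group y → level x < level y → ¬ Opposite x y → Covers levelPoset x y
  covers {x} {y} g l ¬opp = ⊏-intro g l , λ (_ , x⊏w , w⊏y) →
    ¬opp (g , a<b<c≤2⇒a≡0×c≡2 (proj₂ (⊏-elim x⊏w)) (proj₂ (⊏-elim w⊏y)) (level≤2 y))

  ¬Opposite⇒CIEdge : ∀ {x y} → x ≢ y → ¬ Opposite x y → ¬ Opposite y x → CIEdge levelPoset x y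
  ¬Opposite⇒CIEdge {x} {y} x≢y ¬xy ¬yx with group x ℕ.≟ group y
  ... | no g≢ = inj₂ (inj₂ (¬⊑ x≢y (g≢ ∘ proj₁) , ¬⊑ (x≢y ∘ sym) (g≢ ∘ sym ∘ proj₁)))
  ... | yes g with ℕ.<-cmp (level x) (level y)
  ...   | tri< l _ _ = inj₁ (covers g l ¬xy)
  ...   | tri> _ _ l = inj₂ (inj₁ (covers (sym g) l ¬yx))
  ...   | tri≈ _ l≡ _ =
    inj₂ (inj₂ (¬⊑ x≢y (ℕ.<-irrefl l≡ ∘ proj₂) , ¬⊑ (x≢y ∘ sym) (ℕ.<-irrefl (sym l≡) ∘ proj₂)))

  LCA-true⇔CIEdge : ∀ {x y} → x ≢ y → LCA T x y true ⇔ CIEdge levelPoset x y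
  LCA-true⇔CIEdge {x} {y} x≢y = mk⇔ to from
    where
    to : LCA T x y true → CIEdge levelPoset x y
    to l = ¬Opposite⇒CIEdge x≢y (¬false ∘ inj₁) (¬false ∘ inj₂)
      where
      ¬false : ¬ (Opposite x y ⊎ Opposite y x)
      ¬false = true≢false ∘ LCA-functional uq l ∘ Equivalence.from LCA-false⇔Opposite
    from : CIEdge levelPoset x y → LCA T x y true
    from e with LCA-exists T x≢y (all∈ x) (all∈ y)
    ... | true , l = l
    ... | false , l = ⊥-elim ([ (λ o → Opposite⇒¬CIEdge o e) , (λ o → Opposite⇒¬CIEdge o (CIEdge-sym e)) ]′
                                (Equivalence.to LCA-false⇔Opposite l))

module _ {n : ℕ} where

  IsCograph-resp-⇔ : ∀ {G H : Graph n} → (∀ u v → Adj G u v ⇔ Adj H u v) → IsCograph G → IsCograph H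
  IsCograph-resp-⇔ {G} {H} G⇔H cograph (a , b , c , d , distinct , (ab , bc , cd) , (¬ac , ¬ad , ¬bd)) =
    cograph (a , b , c , d , distinct , (from ab , from bc , from cd) , (¬ac ∘ to , ¬ad ∘ to , ¬bd ∘ to))
    where
    from : ∀ {u v} → Adj H u v → Adj G u v
    from = Equivalence.from (G⇔H _ _)
    to : ∀ {u v} → Adj G u v → Adj H u v
    to = Equivalence.to (G⇔H _ _)

  IsCotreeOf-resp-⇔ : ∀ {G H : Graph n} {T} → (∀ u v → Adj G u v ⇔ Adj H u v) →
    IsCotreeOf G T → IsCotreeOf H T
  IsCotreeOf-resp-⇔ G⇔H (wf , uq , all∈ , adj) =
    wf , uq , all∈ , λ x y x≢y → adj x y x≢y ⇔-∘ ⇔-sym (G⇔H x y)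

  module _ (P : FinPoset n) (f : Fin n ↔ Fin n) where
    open Inverse f using (to; from; strictlyInverseˡ; strictlyInverseʳ)

    to-injective : ∀ {u v} → to u ≡ to v → u ≡ v
    to-injective {u} {v} e = trans (sym (strictlyInverseʳ u)) (trans (cong from e) (strictlyInverseʳ v))

    pullback : FinPoset n
    pullback = record
      { _≼_ = λ u v → _≼_ P (to u) (to v)
      ; refl≼ = refl≼ P
      ; antisym≼ = λ u≼v v≼u → to-injective (antisym≼ P u≼v v≼u)
      ; trans≼ = trans≼ P
      }

    Lt-pullback⁺ : ∀ {u v} → Lt pullback u v → Lt P (to u) (to v)
    Lt-pullback⁺ (u≼v , u≢v) = u≼v , u≢v ∘ to-injective

    Lt-pullback⁻ : ∀ {u v} → Lt P (to u) (to v) → Lt pullback u v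
    Lt-pullback⁻ (u≼v , u≢v) = u≼v , u≢v ∘ cong to

    Covers-pullback⁺ : ∀ {u v} → Covers pullback u v → Covers P (to u) (to v)
    Covers-pullback⁺ (u⊏v , ¬between) = Lt-pullback⁺ u⊏v , λ (w , u⊏w , w⊏v) →
      ¬between (from w , Lt-pullback⁻ (subst (Lt P _) (sym (strictlyInverseˡ w)) u⊏w)
                       , Lt-pullback⁻ (subst (λ w′ → Lt P w′ _) (sym (strictlyInverseˡ w)) w⊏v))

    Covers-pullback⁻ : ∀ {u v} → Covers P (to u) (to v) → Covers pullback u v
    Covers-pullback⁻ (u⊏v , ¬between) = Lt-pullback⁻ u⊏v , λ (w , u⊏w , w⊏v) →
      ¬between (to w , Lt-pullback⁺ u⊏w , Lt-pullback⁺ w⊏v)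

    CIEdge-pullback : ∀ u v → CIEdge pullback u v ⇔ CIEdge P (to u) (to v)
    CIEdge-pullback u v = mk⇔ (Sum.map Covers-pullback⁺ (Sum.map Covers-pullback⁺ (λ i → i)))
                              (Sum.map Covers-pullback⁻ (Sum.map Covers-pullback⁻ (λ i → i)))

module _ {n : ℕ} where

  isLeaf? : ∀ (t : Tree n) → Dec (IsLeaf t)
  isLeaf? (leaf _) = yes tt
  isLeaf? (node _ _) = no λ ()

  inner1? : ∀ (t : Tree n) → Dec (Inner1 t)
  inner1? (leaf _) = no λ ()
  inner1? (node false _) = no λ ()
  inner1? (node true cs) = All.all? isLeaf? cs

  zero2? : ∀ (t : Tree n) → Dec (Zero2 t)
  zero2? (leaf _) = no λ ()
  zero2? (node true _) = no λ ()
  zero2? (node false []) = no λ ()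
  zero2? (node false (_ ∷ [])) = no λ ()
  zero2? (node false (a ∷ b ∷ [])) = (isLeaf? a ⊎-dec inner1? a) ×-dec (isLeaf? b ⊎-dec inner1? b)
  zero2? (node false (_ ∷ _ ∷ _ ∷ _)) = no λ ()

  inTC? : ∀ (t : Tree n) → Dec (InTC t)
  inTC? (leaf _) = yes tt
  inTC? (node false _) = no λ ()
  inTC? (node true cs) =
    All.all? (λ c → isLeaf? c ⊎-dec zero2? c) cs ×-dec (countZeroNodes cs ℕ.≤? countLeaves cs)

¬¬-∀-Fin : ∀ {m} {Q : Fin m → Set} → (∀ i → ¬ ¬ Q i) → ¬ ¬ (∀ i → Q i)
¬¬-∀-Fin {zero} _ ¬all = ¬all λ ()
¬¬-∀-Fin {suc m} ¬¬Q ¬all = ¬¬Q zero λ Q₀ → ¬¬-∀-Fin (¬¬Q ∘ suc) λ Qₛ →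
  ¬all λ { zero → Q₀ ; (suc i) → Qₛ i }

¬¬-decidable : ∀ {n} (R : Fin n → Fin n → Set) → ¬ ¬ Decidable R
¬¬-decidable R = ¬¬-∀-Fin λ _ → ¬¬-∀-Fin λ _ → ¬¬-excluded-middle

-- Decidability of the order of P holds only under double negation, which suffices
-- because membership in 𝒯_C is decidable.
CIGraph⇒InTC : ∀ {n} (G : Graph n) → IsCograph G → (T : Tree n) → IsCotreeOf G T → IsCIGraph G → InTC T
CIGraph⇒InTC G cograph T cotree (P , f , G⇔P) =
  decidable-stable (inTC? T) (¬¬-map cotree-InTC′ (¬¬-decidable (_≼_ P′)))
  where
  P′ : FinPoset _
  P′ = pullback P f
  G⇔P′ : ∀ u v → Adj G u v ⇔ CIEdge P′ u v
  G⇔P′ u v = ⇔-sym (CIEdge-pullback P f u v) ⇔-∘ G⇔P u v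
  cotree-InTC′ : Decidable (_≼_ P′) → InTC T
  cotree-InTC′ ≼? = CotreeOfCIGraph.cotree-InTC P′ ≼?
    (IsCograph-resp-⇔ {G = G} {H = ciGraph P′} G⇔P′ cograph)
    (IsCotreeOf-resp-⇔ {G = G} {H = ciGraph P′} G⇔P′ cotree)

IsCIGraph-via-id : ∀ {n} (G : Graph n) (P : FinPoset n) → (∀ u v → u ≢ v → Adj G u v ⇔ CIEdge P u v) →
  IsCIGraph G
IsCIGraph-via-id G P G⇔P = P , ↔-id _ , G⇔P′
  where
  G⇔P′ : ∀ u v → Adj G u v ⇔ CIEdge P u v
  G⇔P′ u v with u Fin.≟ v
  ... | yes refl = mk⇔ (λ a → ⊥-elim (irrefl G a)) (λ e → ⊥-elim (OrderProperties.CIEdge-irrefl P e))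
  ... | no u≢v = G⇔P u v u≢v

InTC⇒CIGraph : ∀ {n} (G : Graph n) (T : Tree n) → IsCotreeOf G T → InTC T → IsCIGraph G
InTC⇒CIGraph G (leaf v) (_ , _ , all∈ , _) _ =
  IsCIGraph-via-id G discrete λ u w u≢w → ⊥-elim (u≢w (trans (only u) (sym (only w))))
  where
  discrete : FinPoset _
  discrete = record { _≼_ = _≡_ ; refl≼ = refl ; antisym≼ = λ u≡v _ → u≡v ; trans≼ = trans }
  only : ∀ u → u ≡ v
  only u with here u≡v ← all∈ u = u≡v
InTC⇒CIGraph G (node true cs) (_ , uq , all∈ , adj) (shape , balanced) =
  IsCIGraph-via-id G levelPoset λ u v u≢v → LCA-true⇔CIEdge u≢v ⇔-∘ adj u v u≢v
  where open CIPoset shape balanced uq all∈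

theorem4p8 : ∀ {n : ℕ} (G : Graph n) → IsCograph G →
    (T : Tree n) → IsCotreeOf G T → (IsCIGraph G ⇔ InTC T)
theorem4p8 G cograph T cotree = mk⇔ (CIGraph⇒InTC G cograph T cotree) (InTC⇒CIGraph G T cotree)
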